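{- The competitive ratio of the Limited Largest Weight (LLW) algorithm is at least $R$.
   Context: We consider the online problem $1\mid r_j,\text{online},p_j=1,\text{restart}\mid WC_{\max}$: jobs with unit processing time, weight $w_j>0$ and release time $r_j$ arrive over time on a single machine and become known at their release time; a running job may be interrupted, but then all work done on it is lost and it must later be run again from the start; the objective is to minimize the weighted makespan $\max_j w_jC_j$. The competitive ratio of an online algorithm ALG is $\sup_I \mathrm{ALG}(I)/\mathrm{OPT}(I)$, where OPT is the optimal offline value. Let $R\approx 1.3098$ be the positive real root of $3R^3-2R^2-R-2=0$. Largest Weight (LW) with interruptions: if the machine is idle, the next arriving job is started when it arrives; a running job is interrupted if a new job with higher weight arrives; if a job is interrupted or finishes and jobs are waiting, the heaviest waiting job starts immediately. LW without interruptions: same rules, except that a started job is never interrupted. The LLW algorithm starts the first arriving job when it arrives. Once it starts a job at time $\frac{2-R}{R-1}$ or later, it runs LW without interruptions until all jobs have finished. Whenever it starts a job at time $t<\frac{2-R}{R-1}\approx 2.2279$, it runs LW with interruptions until time $t'=\frac{t+2}{R}-1$; if an interruption occurs at time $t_i$ during this period, it updates $t:=t_i$ and recomputes $t'=\frac{t+2}{R}-1$. If time $t'$ is reached without an interruption, the running job continues until completion without interruptions, after which the algorithm resumes LW with or without interruptions depending on the current time as just described. -}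

module Defs where

open import Data.Bool using (Bool; true; false; _∧_; if_then_else_)
open import Data.Nat using (ℕ; NonZero)
open import Data.Fin using (Fin) renaming (_≤_ to _≤ᶠ_)
open import Data.Vec using (Vec; lookup; toList)
open import Data.List using (List; []; _∷_)
open import Data.Maybe using (Maybe; just; nothing)
open import Data.Product using (_×_; _,_)
open import Data.Sum using (_⊎_)
open import Relation.Nullary using (does; ¬_)
open import Relation.Binary.PropositionalEquality using (_≡_)
open import Data.Integer using (+_)
open import Data.Rational using (ℚ; 0ℚ; 1ℚ; _+_; _*_; _-_; _≤_; _<_; _⊔_; _/_)
open import Data.Rational.Properties using (_≤?_; _<?_; _≟_)

-- The constant R: the unique positive real root of 3R³ − 2R² − R − 2 = 0.
-- There are no reals in agda-stdlib; R is irrational, so we only ever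
-- compare R with rationals.  By Descartes' rule the cubic f has exactly one
-- positive root R, f < 0 on (0,R) and f > 0 on (R,∞); f has no rational root.

2ℚ 3ℚ : ℚ
2ℚ = + 2 / 1
3ℚ = + 3 / 1

cubic : ℚ → ℚ
cubic x = 3ℚ * (x * x * x) - 2ℚ * (x * x) - x - 2ℚ

_<R : ℚ → Set
q <R = q ≤ 0ℚ ⊎ cubic q < 0ℚ

R<? : ℚ → Bool
R<? q = does (0ℚ <? q) ∧ does (0ℚ <? cubic q)

record Job : Set where
  constructor job
  field
    rel : ℚ
    wt  : ℚ   -- weight w_j   (processing time is 1)
open Job public

-- A valid instance with n jobs, listed in order of release (ties in list
-- order = order in which simultaneously released jobs are presented).
record ValidInstance {n : ℕ} (I : Vec Job n) : Set where
  field
    rel-nonneg : ∀ i → 0ℚ ≤ rel (lookup I i)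
    wt-pos     : ∀ i → 0ℚ < wt (lookup I i)
    sorted     : ∀ i j → i ≤ᶠ j → rel (lookup I i) ≤ rel (lookup I j)

-- Offline schedules (OPT).  Restarts never help offline, so a feasible
-- schedule assigns each job a start time S_i ≥ r_i with the unit intervals
-- [S_i, S_i + 1) pairwise disjoint.

Feasible : {n : ℕ} → Vec Job n → (Fin n → ℚ) → Set
Feasible {n} I S =
  (∀ i → rel (lookup I i) ≤ S i) ×
  (∀ i j → ¬ (i ≡ j) → (S i + 1ℚ ≤ S j) ⊎ (S j + 1ℚ ≤ S i))

-- max over jobs of w_j C_j  (instances considered are nonempty, weights > 0)
maxOver : {n : ℕ} → (Fin n → ℚ) → ℚ
maxOver {ℕ.zero} f = 0ℚ
maxOver {ℕ.suc n} f = f Fin.zero ⊔ maxOver (λ i → f (Fin.suc i))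

value : {n : ℕ} → Vec Job n → (Fin n → ℚ) → ℚ
value I S = maxOver (λ i → wt (lookup I i) * (S i + 1ℚ))

-- A job started at time s is
-- interruptible at an arrival time a iff s < (2−R)/(R−1) and
-- a < (s+2)/R − 1.  For s, a ≥ 0 these are  R < (s+2)/(s+1)  and
-- R < (s+2)/(a+1).  (Both thresholds are irrational for rational s, so
-- boundary cases cannot occur.)

-- homogenised test "R < p / d" for d > 0:  p > 0 and d³·f(p/d) > 0
R<frac : ℚ → ℚ → Bool
R<frac p d = does (0ℚ <? p) ∧
  does (0ℚ <? (3ℚ * (p * p * p) - 2ℚ * (p * p * d) - p * d * d - 2ℚ * (d * d * d)))

interruptible : ℚ → ℚ → Bool
interruptible s a = R<frac (s + 2ℚ) (s + 1ℚ) ∧ R<frac (s + 2ℚ) (a + 1ℚ)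

-- waiting jobs kept sorted by non-increasing weight (stable: a job inserted
-- goes after those of equal weight), so the head is the heaviest waiting job
insertW : Job → List Job → List Job
insertW j [] = j ∷ []
insertW j (k ∷ W) = if does (wt k <? wt j) then j ∷ k ∷ W else k ∷ insertW j W

Running : Set
Running = Maybe (Job × ℚ)

record SimState : Set where
  constructor st
  field
    running : Running
    waiting : List Job    -- released, unfinished, not running
    acc     : ℚ           -- max of w_j C_j over completed jobs

-- A job
-- completing exactly at T leaves the machine idle; the start decision at T
-- is taken after the jobs released at T have arrived.
advance : ℚ → Running → List Job → ℚ → SimState
advance T nothing W a = st nothing W a
advance T (just (j , s)) W a with does ((s + 1ℚ) ≤? T)
... | false = st (just (j , s)) W a
... | true = next W
  where
  a' = a ⊔ (wt j * (s + 1ℚ))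
  next : List Job → SimState
  next [] = st nothing [] a'
  next (k ∷ W') with does ((s + 1ℚ) <? T)
  ... | true  = advance T (just (k , s + 1ℚ)) W' a'
  ... | false = st nothing (k ∷ W') a'

arrive : Job → SimState → SimState
arrive j (st (just (k , s)) W a) with interruptible s (rel j) ∧ does (wt k <? wt j)
... | true  = st (just (j , rel j)) (insertW k W) a
... | false = st (just (k , s)) (insertW j W) a
arrive j (st nothing W a) = st nothing (insertW j W) a

startIdle : ℚ → SimState → SimState
startIdle t (st nothing (k ∷ W) a) = st (just (k , t)) W a
startIdle t σ = σ

drain : Running → List Job → ℚ → ℚ
drain nothing W a = a
drain (just (j , s)) [] a = a ⊔ (wt j * (s + 1ℚ))
drain (just (j , s)) (k ∷ W) a = drain (just (k , s + 1ℚ)) W (a ⊔ (wt j * (s + 1ℚ)))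

sameTime : Job → List Job → Bool
sameTime j [] = false
sameTime j (k ∷ _) = does (rel j ≟ rel k)

simulate : List Job → SimState → ℚ
simulate [] (st ρ W a) = drain ρ W a
simulate (j ∷ js) (st ρ W a) =
  let σ = arrive j (advance (rel j) ρ W a) in
  simulate js (if sameTime j js then σ else startIdle (rel j) σ)

LLW : {n : ℕ} → Vec Job n → ℚ
LLW I = simulate (toList I) (st nothing [] 0ℚ)

-- For 1 < q < R put d = 2/q and present a job of weight 1 at time 0 and a job
-- of weight 2 at time d − 1 ∈ (0,1).  LLW starts the light job and, since
-- (0+2)/R − 1 < d − 1 exactly when q < R, may not interrupt it when the heavy
-- job arrives; so the heavy job completes at 2 and LLW pays 4.  Running the
-- heavy job first costs max(2d, d + 1) = 2d = 4/q.  For q ≤ 1 a single job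
-- suffices.
module Submission where

open import Defs
open import Data.Nat using (ℕ; NonZero)
open import Data.Fin using (Fin)
open import Data.Vec using (Vec)
open import Data.Product using (Σ; _×_; ∃)
open import Data.Rational using (ℚ; _*_; _≤_)

open import Data.Bool using (false; _∧_)
open import Data.Bool.Properties using (∧-zeroʳ)
open import Data.Fin using (zero; suc)
open import Data.Vec using (_∷_; []; lookup)
open import Data.Product using (_,_)
open import Data.Sum using (inj₁; inj₂)
open import Data.Empty using (⊥-elim)
open import Relation.Nullary using (yes; no; does)
open import Relation.Nullary.Decidable using (from-yes; dec-false)
open import Relation.Binary.PropositionalEquality
  using (_≡_; refl; sym; trans; cong; subst; subst₂; module ≡-Reasoning)
open import Data.Integer using (+_)
open import Data.Rational
  using (0ℚ; 1ℚ; _+_; _-_; _<_; _/_; 1/_; -_; Positive; NonNegative; positive; nonNegative)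
  renaming (NonZero to NonZeroℚ)
open import Data.Rational.Properties
open import Data.Rational.Solver using (module +-*-Solver)
open +-*-Solver

4ℚ 12ℚ 16ℚ 27ℚ : ℚ
4ℚ  = + 4 / 1
12ℚ = + 12 / 1
16ℚ = + 16 / 1
27ℚ = + 27 / 1

RatioAtLeast : ℚ → Set
RatioAtLeast q =
  Σ ℕ λ n → NonZero n × Σ (Vec Job n) λ I → ValidInstance I ×
    Σ (Fin n → ℚ) λ S → Feasible I S × (q * value I S ≤ LLW I)

cubic-around-2 : ∀ q → cubic q ≡ 12ℚ + (q - 2ℚ) * (27ℚ + (q - 2ℚ) * (16ℚ + 3ℚ * (q - 2ℚ)))
cubic-around-2 = solve 1 (λ q →
    con 3ℚ :* (q :* q :* q) :- con 2ℚ :* (q :* q) :- q :- con 2ℚ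
  := con 12ℚ :+ (q :- con 2ℚ) :* (con 27ℚ :+ (q :- con 2ℚ) :* (con 16ℚ :+ con 3ℚ :* (q :- con 2ℚ))))
  refl

cubic-pos-from-2 : ∀ q → 2ℚ ≤ q → 0ℚ < cubic q
cubic-pos-from-2 q 2≤q = begin-strict
  0ℚ             <⟨ from-yes (0ℚ <? 12ℚ) ⟩
  12ℚ            ≡⟨ sym (+-identityʳ 12ℚ) ⟩
  12ℚ + 0ℚ       ≤⟨ +-monoʳ-≤ 12ℚ (nonNegative⁻¹ (t * (27ℚ + t * (16ℚ + 3ℚ * t)))) ⟩
  12ℚ + t * (27ℚ + t * (16ℚ + 3ℚ * t)) ≡⟨ sym (cubic-around-2 q) ⟩
  cubic q        ∎
  where
  open ≤-Reasoning
  t = q - 2ℚ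
  instance
    t≥0 : NonNegative t
    t≥0 = nonNegative (subst (_≤ t) (+-inverseʳ 2ℚ) (+-monoˡ-≤ (- 2ℚ) 2≤q))
    tail≥0 : NonNegative (16ℚ + 3ℚ * t)
    tail≥0 = nonNeg+nonNeg⇒nonNeg 16ℚ (3ℚ * t) {{nonNeg*nonNeg⇒nonNeg 3ℚ t}}
    mid≥0 : NonNegative (27ℚ + t * (16ℚ + 3ℚ * t))
    mid≥0 = nonNeg+nonNeg⇒nonNeg 27ℚ (t * (16ℚ + 3ℚ * t)) {{nonNeg*nonNeg⇒nonNeg t (16ℚ + 3ℚ * t)}}
    all≥0 : NonNegative (t * (27ℚ + t * (16ℚ + 3ℚ * t)))
    all≥0 = nonNeg*nonNeg⇒nonNeg t (27ℚ + t * (16ℚ + 3ℚ * t))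

cubic-neg⇒<2 : ∀ q → cubic q < 0ℚ → q < 2ℚ
cubic-neg⇒<2 q cubic<0 with q <? 2ℚ
... | yes q<2 = q<2
... | no q≮2 = ⊥-elim (<-asym cubic<0 (cubic-pos-from-2 q (≮⇒≥ q≮2)))

R<frac-scaled-false : ∀ q d → 0ℚ < d → cubic q < 0ℚ → R<frac (q * d) d ≡ false
R<frac-scaled-false q d 0<d cubic<0 =
  trans (cong (does (0ℚ <? q * d) ∧_) (dec-false (0ℚ <? _) (<-asym negative)))
        (∧-zeroʳ _)
  where
  homogenised : 3ℚ * ((q * d) * (q * d) * (q * d)) - 2ℚ * ((q * d) * (q * d) * d)
                  - (q * d) * d * d - 2ℚ * (d * d * d)
              ≡ (d * d * d) * cubic q
  homogenised = solve 2 (λ q d →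
      con 3ℚ :* ((q :* d) :* (q :* d) :* (q :* d)) :- con 2ℚ :* ((q :* d) :* (q :* d) :* d)
        :- (q :* d) :* d :* d :- con 2ℚ :* (d :* d :* d)
    := (d :* d :* d) :* (con 3ℚ :* (q :* q :* q) :- con 2ℚ :* (q :* q) :- q :- con 2ℚ))
    refl q d
  instance
    d>0 : Positive d
    d>0 = positive 0<d
    d³>0 : Positive (d * d * d)
    d³>0 = pos*pos⇒pos (d * d) {{pos*pos⇒pos d d}} d
  negative : _ < 0ℚ
  negative = subst₂ _<_ (sym homogenised) (*-zeroʳ (d * d * d))
               (*-monoʳ-<-pos (d * d * d) cubic<0)

trap : ℚ → Vec Job 2
trap a = job 0ℚ 1ℚ ∷ job a 2ℚ ∷ []

-- The heavy job is not released together with the light one, finds it still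
-- running, and may not interrupt it.
LLW-trap : ∀ a → 0ℚ < a → a < 1ℚ → R<frac 2ℚ (a + 1ℚ) ≡ false → LLW (trap a) ≡ 4ℚ
LLW-trap a 0<a a<1 no-interrupt
  rewrite dec-false (0ℚ ≟ a) (<⇒≢ 0<a)
        | dec-false (1ℚ ≤? a) (λ 1≤a → <-irrefl refl (≤-<-trans 1≤a a<1))
        | no-interrupt
        = refl

trap-valid : ∀ a → 0ℚ ≤ a → ValidInstance (trap a)
trap-valid a 0≤a = record
  { rel-nonneg = λ { zero → ≤-refl ; (suc zero) → 0≤a }
  ; wt-pos     = λ { zero → from-yes (0ℚ <? 1ℚ) ; (suc zero) → from-yes (0ℚ <? 2ℚ) }
  ; sorted     = λ { zero zero _ → ≤-refl ; zero (suc zero) _ → 0≤a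
                   ; (suc zero) zero () ; (suc zero) (suc zero) _ → ≤-refl }
  }

heavy-first : ℚ → Fin 2 → ℚ
heavy-first a = lookup (a + 1ℚ ∷ a ∷ [])

heavy-first-feasible : ∀ a → 0ℚ ≤ a → Feasible (trap a) (heavy-first a)
heavy-first-feasible a 0≤a =
    (λ { zero → ≤-trans 0≤a a≤a+1 ; (suc zero) → ≤-refl })
  , λ { zero zero 0≢0 → ⊥-elim (0≢0 refl)
      ; zero (suc zero) _ → inj₂ ≤-refl
      ; (suc zero) zero _ → inj₁ ≤-refl
      ; (suc zero) (suc zero) 1≢1 → ⊥-elim (1≢1 refl) }
  where
  a≤a+1 : a ≤ a + 1ℚ
  a≤a+1 = subst (_≤ a + 1ℚ) (+-identityʳ a) (+-monoʳ-≤ a (from-yes (0ℚ ≤? 1ℚ)))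

value-heavy-first : ∀ a → 0ℚ ≤ a → value (trap a) (heavy-first a) ≤ 2ℚ * (a + 1ℚ)
value-heavy-first a 0≤a = ⊔-lub light-job (⊔-lub ≤-refl (nonNegative⁻¹ (2ℚ * (a + 1ℚ))))
  where
  instance
    a+1≥0 : NonNegative (a + 1ℚ)
    a+1≥0 = nonNeg+nonNeg⇒nonNeg a {{nonNegative 0≤a}} 1ℚ
    2[a+1]≥0 : NonNegative (2ℚ * (a + 1ℚ))
    2[a+1]≥0 = nonNeg*nonNeg⇒nonNeg 2ℚ (a + 1ℚ)
  light-job : 1ℚ * (a + 1ℚ + 1ℚ) ≤ 2ℚ * (a + 1ℚ)
  light-job = begin
    1ℚ * (a + 1ℚ + 1ℚ)    ≡⟨ *-identityˡ (a + 1ℚ + 1ℚ) ⟩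
    (a + 1ℚ) + 1ℚ         ≤⟨ +-monoʳ-≤ (a + 1ℚ) (+-monoˡ-≤ 1ℚ 0≤a) ⟩
    (a + 1ℚ) + (a + 1ℚ)   ≡⟨ solve 1 (λ x → x :+ x := con 2ℚ :* x) refl (a + 1ℚ) ⟩
    2ℚ * (a + 1ℚ)         ∎
    where open ≤-Reasoning

trap-ratio : ∀ q a → 0ℚ ≤ q → 0ℚ < a → a < 1ℚ → R<frac 2ℚ (a + 1ℚ) ≡ false →
             q * (a + 1ℚ) ≡ 2ℚ → RatioAtLeast q
trap-ratio q a 0≤q 0<a a<1 no-interrupt q[a+1]≡2 =
  2 , _ , trap a , trap-valid a 0≤a , heavy-first a , heavy-first-feasible a 0≤a , bound
  where
  0≤a : 0ℚ ≤ a
  0≤a = <⇒≤ 0<a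
  instance
    q≥0 : NonNegative q
    q≥0 = nonNegative 0≤q
  bound : q * value (trap a) (heavy-first a) ≤ LLW (trap a)
  bound = begin
    q * value (trap a) (heavy-first a) ≤⟨ *-monoˡ-≤-nonNeg q (value-heavy-first a 0≤a) ⟩
    q * (2ℚ * (a + 1ℚ))                ≡⟨ solve 2 (λ q x → q :* (con 2ℚ :* x) := con 2ℚ :* (q :* x))
                                                  refl q (a + 1ℚ) ⟩
    2ℚ * (q * (a + 1ℚ))                ≡⟨ cong (2ℚ *_) q[a+1]≡2 ⟩
    2ℚ * 2ℚ                            ≡⟨ sym (LLW-trap a 0<a a<1 no-interrupt) ⟩
    LLW (trap a)                       ∎
    where open ≤-Reasoning

ratio-above-1 : ∀ q → 1ℚ < q → cubic q < 0ℚ → RatioAtLeast q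
ratio-above-1 q 1<q cubic<0 = trap-ratio q a (<⇒≤ 0<q) 0<a a<1 no-interrupt q[a+1]≡2
  where
  0<q : 0ℚ < q
  0<q = <-trans (from-yes (0ℚ <? 1ℚ)) 1<q
  instance
    q>0 : Positive q
    q>0 = positive 0<q
    q≥0 : NonNegative q
    q≥0 = pos⇒nonNeg q
    q≢0 : NonZeroℚ q
    q≢0 = pos⇒nonZero q

  d a : ℚ
  d = 2ℚ * 1/ q
  a = d - 1ℚ

  qd≡2 : q * d ≡ 2ℚ
  qd≡2 = begin
    q * (2ℚ * 1/ q)   ≡⟨ solve 2 (λ q x → q :* (con 2ℚ :* x) := con 2ℚ :* (q :* x)) refl q (1/ q) ⟩
    2ℚ * (q * 1/ q)   ≡⟨ cong (2ℚ *_) (*-inverseʳ q) ⟩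
    2ℚ * 1ℚ           ≡⟨ *-identityʳ 2ℚ ⟩
    2ℚ                ∎
    where open ≡-Reasoning

  a+1≡d : a + 1ℚ ≡ d
  a+1≡d = solve 1 (λ d → d :- con 1ℚ :+ con 1ℚ := d) refl d

  q[a+1]≡2 : q * (a + 1ℚ) ≡ 2ℚ
  q[a+1]≡2 = trans (cong (q *_) a+1≡d) qd≡2

  1<d : 1ℚ < d
  1<d = *-cancelˡ-<-nonNeg q (subst₂ _<_ (sym (*-identityʳ q)) (sym qd≡2) (cubic-neg⇒<2 q cubic<0))

  0<d : 0ℚ < d
  0<d = <-trans (from-yes (0ℚ <? 1ℚ)) 1<d

  d<2 : d < 2ℚ
  d<2 = *-cancelˡ-<-nonNeg q (subst₂ _<_ (sym qd≡2) (*-comm 2ℚ q)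
          (subst (_< 2ℚ * q) (*-identityʳ 2ℚ) (*-monoʳ-<-pos 2ℚ 1<q)))

  0<a : 0ℚ < a
  0<a = +-monoˡ-< (- 1ℚ) 1<d

  a<1 : a < 1ℚ
  a<1 = +-monoˡ-< (- 1ℚ) d<2

  no-interrupt : R<frac 2ℚ (a + 1ℚ) ≡ false
  no-interrupt = subst (λ p → R<frac p (a + 1ℚ) ≡ false) q[a+1]≡2
    (R<frac-scaled-false q (a + 1ℚ) (subst (0ℚ <_) (sym a+1≡d) 0<d) cubic<0)

ratio-at-most-1 : ∀ q → q ≤ 1ℚ → RatioAtLeast q
ratio-at-most-1 q q≤1 =
  1 , _ , I , valid , (λ _ → 0ℚ) , ((λ { zero → ≤-refl }) , λ { zero zero 0≢0 → ⊥-elim (0≢0 refl) })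
  , subst (_≤ 1ℚ) (sym (*-identityʳ q)) q≤1
  where
  I : Vec Job 1
  I = job 0ℚ 1ℚ ∷ []
  valid : ValidInstance I
  valid = record
    { rel-nonneg = λ { zero → ≤-refl }
    ; wt-pos     = λ { zero → from-yes (0ℚ <? 1ℚ) }
    ; sorted     = λ { zero zero _ → ≤-refl }
    }

lemma1 : (q : ℚ) → q <R →
    Σ ℕ λ n → NonZero n × Σ (Vec Job n) λ I → ValidInstance I ×
    Σ (Fin n → ℚ) λ S → Feasible I S × (q * value I S ≤ LLW I)
lemma1 q q<R with q ≤? 1ℚ | q<R
... | yes q≤1 | _            = ratio-at-most-1 q q≤1
... | no  q≰1 | inj₁ q≤0     = ⊥-elim (q≰1 (≤-trans q≤0 (from-yes (0ℚ ≤? 1ℚ))))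
... | no  q≰1 | inj₂ cubic<0 = ratio-above-1 q (≰⇒> q≰1) cubic<0
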